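{- Let $\varphi$ be an indecomposable order type different from $1$. If $\varphi$ is equimorphic to an order type with only finitely many finite $F$-classes, then $\varphi$ is equimorphic to an order type all of whose $F$-classes are infinite.
   Context: Work in ZFC. For order types, $\varphi\leqslant\psi$ means an order of type $\varphi$ embeds in one of type $\psi$; types are equimorphic if each embeds in the other. A type $\varphi$ is indecomposable if whenever $\varphi=\psi+\tau$ (a copy of $\psi$ followed by a copy of $\tau$), then $\varphi\leqslant\psi$ or $\varphi\leqslant\tau$. For a linear order $X$, the finite condensation $F$ relates $x,x'$ iff the closed interval between them is finite; its equivalence classes are the $F$-classes. -}

module Defs where

open import Level using (Level; _⊔_; suc)
open import Data.Sum using (_⊎_; inj₁; inj₂)
open import Data.Product using (Σ; ∃; _×_; _,_)
open import Data.Empty.Polymorphic using (⊥)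
open import Data.Unit.Polymorphic using (⊤)
open import Data.List using (List)
open import Data.List.Membership.Propositional using (_∈_)
open import Relation.Nullary using (¬_)
open import Relation.Binary.PropositionalEquality using (_≡_)

-- A (strict) linear order: an arbitrary type with an irreflexive,
-- transitive, trichotomous relation.  Its order type is its isomorphism class.
record LinOrd (ℓ : Level) : Set (suc ℓ) where
  field
    Carrier : Set ℓ
    _<_     : Carrier → Carrier → Set ℓ
    irrefl  : ∀ x → ¬ (x < x)
    trans   : ∀ {x y z} → x < y → y < z → x < z
    trich   : ∀ x y → (x < y) ⊎ ((x ≡ y) ⊎ (y < x))

  _≤_ : Carrier → Carrier → Set ℓ
  x ≤ y = (x < y) ⊎ (x ≡ y)

open LinOrd public

_⩽_ : ∀ {ℓ} → LinOrd ℓ → LinOrd ℓ → Set ℓ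
A ⩽ B = Σ (Carrier A → Carrier B) λ f →
          ∀ x y → _<_ A x y → _<_ B (f x) (f y)

Equimorphic : ∀ {ℓ} → LinOrd ℓ → LinOrd ℓ → Set ℓ
Equimorphic A B = (A ⩽ B) × (B ⩽ A)

_≅_ : ∀ {ℓ} → LinOrd ℓ → LinOrd ℓ → Set ℓ
A ≅ B = Σ (Carrier A → Carrier B) λ f → Σ (Carrier B → Carrier A) λ g →
          (∀ x → g (f x) ≡ x) × (∀ y → f (g y) ≡ y) ×
          (∀ x y → _<_ A x y → _<_ B (f x) (f y)) ×
          (∀ x y → _<_ B x y → _<_ A (g x) (g y))

data SumLt {ℓ} (A B : LinOrd ℓ) : Carrier A ⊎ Carrier B → Carrier A ⊎ Carrier B → Set ℓ where
  ll : ∀ {a a'} → _<_ A a a' → SumLt A B (inj₁ a) (inj₁ a')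
  lr : ∀ {a b} → SumLt A B (inj₁ a) (inj₂ b)
  rr : ∀ {b b'} → _<_ B b b' → SumLt A B (inj₂ b) (inj₂ b')

_⊕_ : ∀ {ℓ} → LinOrd ℓ → LinOrd ℓ → LinOrd ℓ
A ⊕ B = record
  { Carrier = Carrier A ⊎ Carrier B
  ; _<_ = SumLt A B
  ; irrefl = irr
  ; trans = tr
  ; trich = tri
  }
  where
  irr : ∀ x → ¬ SumLt A B x x
  irr (inj₁ a) (ll p) = irrefl A a p
  irr (inj₂ b) (rr p) = irrefl B b p
  tr : ∀ {x y z} → SumLt A B x y → SumLt A B y z → SumLt A B x z
  tr (ll p) (ll q) = ll (trans A p q)
  tr (ll p) lr = lr
  tr lr (rr q) = lr
  tr (rr p) (rr q) = rr (trans B p q)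
  tri : ∀ x y → SumLt A B x y ⊎ ((x ≡ y) ⊎ SumLt A B y x)
  tri (inj₁ a) (inj₁ a') with trich A a a'
  ... | inj₁ p = inj₁ (ll p)
  ... | inj₂ (inj₁ Relation.Binary.PropositionalEquality.refl) = inj₂ (inj₁ Relation.Binary.PropositionalEquality.refl)
  ... | inj₂ (inj₂ p) = inj₂ (inj₂ (ll p))
  tri (inj₁ a) (inj₂ b) = inj₁ lr
  tri (inj₂ b) (inj₁ a) = inj₂ (inj₂ lr)
  tri (inj₂ b) (inj₂ b') with trich B b b'
  ... | inj₁ p = inj₁ (rr p)
  ... | inj₂ (inj₁ Relation.Binary.PropositionalEquality.refl) = inj₂ (inj₁ Relation.Binary.PropositionalEquality.refl)
  ... | inj₂ (inj₂ p) = inj₂ (inj₂ (rr p))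

One : ∀ {ℓ} → LinOrd ℓ
One = record
  { Carrier = ⊤
  ; _<_ = λ _ _ → ⊥
  ; irrefl = λ _ ()
  ; trans = λ ()
  ; trich = λ _ _ → inj₂ (inj₁ Relation.Binary.PropositionalEquality.refl)
  }

Indecomposable : ∀ {ℓ} → LinOrd ℓ → Set (suc ℓ)
Indecomposable {ℓ} φ = ∀ (ψ τ : LinOrd ℓ) → φ ≅ (ψ ⊕ τ) → (φ ⩽ ψ) ⊎ (φ ⩽ τ)

FiniteSet : ∀ {ℓ} {A : Set ℓ} → (A → Set ℓ) → Set ℓ
FiniteSet {A = A} P = Σ (List A) λ xs → ∀ z → P z → z ∈ xs

module _ {ℓ} (X : LinOrd ℓ) where
  Between : Carrier X → Carrier X → Carrier X → Set ℓ
  Between x x' z = (_≤_ X x z × _≤_ X z x') ⊎ (_≤_ X x' z × _≤_ X z x)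

  F : Carrier X → Carrier X → Set ℓ
  F x x' = FiniteSet (Between x x')

  FiniteClass : Carrier X → Set ℓ
  FiniteClass x = FiniteSet (F x)

  FinitelyManyFiniteClasses : Set ℓ
  FinitelyManyFiniteClasses =
    Σ (List (Carrier X)) λ rs → ∀ x → FiniteClass x → Σ (Carrier X) λ r → (r ∈ rs) × F x r

  AllClassesInfinite : Set ℓ
  AllClassesInfinite = ∀ x → ¬ FiniteClass x

{-# OPTIONS --safe #-}
-- Only finitely many points of χ lie in finite F-classes. Deleting them leaves
-- a suborder χ′ of χ in which every F-class is infinite, since it contains the
-- (infinite) F-class of the same point in χ; and χ′ embeds in χ, hence in φ.
-- Conversely an embedding f : φ → χ can be pushed off any single point c of χ:
-- by indecomposability φ embeds in one side of the cut {x | f x < c} of itself,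
-- and, on the upper side, in one side of the cut {x | f x = c}. The part sent
-- onto c has at most one point, so it can absorb φ only when φ is empty (and
-- then φ itself is a witness) or of type 1.
module Submission where

open import Defs
open import Level using (Level; lift)
open import Data.Product using (Σ; _×_; _,_; proj₁; proj₂)
open import Data.Sum using (_⊎_; inj₁; inj₂; [_,_]; [_,_]′)
import Data.Sum as Sum
import Data.Product as Product
open import Data.Empty using (⊥-elim)
open import Data.Bool.Properties using (T-irrelevant)
open import Data.Maybe using (Maybe; just; nothing)
open import Data.List using (List; []; _∷_; _++_; map; concatMap; mapMaybe)
open import Data.List.Membership.Propositional using (_∈_; _∉_; lose)
open import Data.List.Membership.Propositional.Properties using (∈-map⁺; ∈-concatMap⁺; ∈-++⁺ˡ; ∈-++⁺ʳ)
open import Data.List.Relation.Unary.Any using (here; there)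
open import Relation.Nullary using (¬_; Dec; yes; no; ¬?; Irrelevant)
open import Relation.Nullary.Decidable using (True; toWitness; fromWitness)
open import Relation.Unary using (Pred; Decidable)
open import Relation.Binary.PropositionalEquality using (_≡_; _≢_; refl; cong; subst; subst₂)
open import Axiom.ExcludedMiddle using (ExcludedMiddle)

private
  variable
    ℓ p : Level
    A : Set p

-- Splitting through decide instead of a with on P? x keeps the maps defined
-- this way open to equational reasoning: abstracting P? x would make terms
-- of type Carrier (Restrict X P?) ill-typed.
decide : (d : Dec A) → True d ⊎ True (¬? d)
decide (yes _) = inj₁ _
decide (no _) = inj₂ _

decide-yes : (d : Dec A) (t : True d) → decide d ≡ inj₁ t
decide-yes (yes _) _ = refl

decide-no : (d : Dec A) (t : True (¬? d)) → decide d ≡ inj₂ t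
decide-no (no _) _ = refl

-- The orders of an embedding cannot be inferred from the Σ-type _⩽_ unfolds
-- to, so uses of _∘⩽_ and ⩽-refl name them explicitly.
_∘⩽_ : {A B C : LinOrd ℓ} → B ⩽ C → A ⩽ B → A ⩽ C
(g , g-mono) ∘⩽ (f , f-mono) = (λ x → g (f x)) , λ x y x<y → g-mono (f x) (f y) (f-mono x y x<y)

⩽-refl : {A : LinOrd ℓ} → A ⩽ A
⩽-refl = (λ x → x) , λ _ _ x<y → x<y

module _ (X : LinOrd ℓ) where

  <-dec : ∀ x y → Dec (_<_ X x y)
  <-dec x y with trich X x y
  ... | inj₁ x<y = yes x<y
  ... | inj₂ (inj₁ refl) = no (irrefl X x)
  ... | inj₂ (inj₂ y<x) = no λ x<y → irrefl X x (trans X x<y y<x)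

  ≡-dec : ∀ x y → Dec (x ≡ y)
  ≡-dec x y with trich X x y
  ... | inj₁ x<y = no λ { refl → irrefl X x x<y }
  ... | inj₂ (inj₁ x≡y) = yes x≡y
  ... | inj₂ (inj₂ y<x) = no λ { refl → irrefl X x y<x }

  <⇒≢ : ∀ {x y} → _<_ X x y → x ≢ y
  <⇒≢ {x} x<y refl = irrefl X x x<y

  constant-⩽⇒irrelevant : {A : LinOrd ℓ} (f : A ⩽ X) (c : Carrier X) →
    (∀ a → proj₁ f a ≡ c) → Irrelevant (Carrier A)
  constant-⩽⇒irrelevant {A} (f , f-mono) c f≡c a b with trich A a b
  ... | inj₁ a<b = ⊥-elim (irrefl X c (subst₂ (_<_ X) (f≡c a) (f≡c b) (f-mono a b a<b)))
  ... | inj₂ (inj₁ a≡b) = a≡b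
  ... | inj₂ (inj₂ b<a) = ⊥-elim (irrefl X c (subst₂ (_<_ X) (f≡c b) (f≡c a) (f-mono b a b<a)))

  irrelevant⇒≅One : Irrelevant (Carrier X) → Carrier X → X ≅ One
  irrelevant⇒≅One irr x = (λ _ → lift _) , (λ _ → x) , irr x , (λ _ → refl) ,
    (λ a b a<b → ⊥-elim (irrefl X a (subst (_<_ X a) (irr b a) a<b))) , λ _ _ ()

  DownClosed : Pred (Carrier X) p → Set _
  DownClosed P = ∀ {x y} → _<_ X x y → P y → P x

module _ (X : LinOrd ℓ) where

  <-DownClosed : {A : LinOrd ℓ} (f : A ⩽ X) (c : Carrier X) →
    DownClosed A (λ a → _<_ X (proj₁ f a) c)
  <-DownClosed (f , f-mono) c a<b fb<c = trans X (f-mono _ _ a<b) fb<c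

  ≡-DownClosed : {A : LinOrd ℓ} (f : A ⩽ X) (c : Carrier X) →
    (∀ a → ¬ _<_ X (proj₁ f a) c) → DownClosed A (λ a → proj₁ f a ≡ c)
  ≡-DownClosed (f , f-mono) c not-below {a} a<b fb≡c =
    ⊥-elim (not-below a (subst (_<_ X (f a)) fb≡c (f-mono _ _ a<b)))

-- Membership is True (P? x) rather than P x because it must be proof-irrelevant,
-- whereas P (for instance x < c) need not be.
module _ (X : LinOrd ℓ) {P : Pred (Carrier X) p} (P? : Decidable P) where

  Restrict : LinOrd ℓ
  Restrict = record
    { Carrier = Σ (Carrier X) (λ x → True (P? x))
    ; _<_ = λ a b → _<_ X (proj₁ a) (proj₁ b)
    ; irrefl = λ a → irrefl X (proj₁ a)
    ; trans = trans X
    ; trich = trich′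
    }
    where
    trich′ : ∀ a b → _<_ X (proj₁ a) (proj₁ b) ⊎ ((a ≡ b) ⊎ _<_ X (proj₁ b) (proj₁ a))
    trich′ (x , t) (y , u) with trich X x y
    ... | inj₁ x<y = inj₁ x<y
    ... | inj₂ (inj₁ refl) = inj₂ (inj₁ (cong (x ,_) (T-irrelevant t u)))
    ... | inj₂ (inj₂ y<x) = inj₂ (inj₂ y<x)

  Restrict-⩽ : Restrict ⩽ X
  Restrict-⩽ = proj₁ , λ _ _ a<b → a<b

  restrict : Carrier X → Maybe (Carrier Restrict)
  restrict x = [ (λ t → just (x , t)) , (λ _ → nothing) ]′ (decide (P? x))

  restrict-proj₁ : ∀ a → restrict (proj₁ a) ≡ just a
  restrict-proj₁ (x , t) = cong [ (λ t → just (x , t)) , (λ _ → nothing) ]′ (decide-yes (P? x) t)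

  ∈-mapMaybe-restrict : ∀ {a} ws → proj₁ a ∈ ws → a ∈ mapMaybe restrict ws
  ∈-mapMaybe-restrict {a} (_ ∷ _) (here refl) rewrite restrict-proj₁ a = here refl
  ∈-mapMaybe-restrict (w ∷ ws) (there a∈ws) with restrict w
  ... | just _ = there (∈-mapMaybe-restrict ws a∈ws)
  ... | nothing = ∈-mapMaybe-restrict ws a∈ws

  Between-proj₁ : ∀ {a b w} → Between Restrict a b w → Between X (proj₁ a) (proj₁ b) (proj₁ w)
  Between-proj₁ = Sum.map (Product.map ≤-proj₁ ≤-proj₁) (Product.map ≤-proj₁ ≤-proj₁)
    where
    ≤-proj₁ : ∀ {a b} → _≤_ Restrict a b → _≤_ X (proj₁ a) (proj₁ b)
    ≤-proj₁ (inj₁ a<b) = inj₁ a<b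
    ≤-proj₁ (inj₂ refl) = inj₂ refl

  F-restrict : ∀ {a b} → F X (proj₁ a) (proj₁ b) → F Restrict a b
  F-restrict (ws , covers) = mapMaybe restrict ws , λ w w∈[a,b] →
    ∈-mapMaybe-restrict ws (covers (proj₁ w) (Between-proj₁ w∈[a,b]))

  ⩽Restrict⁺ : {A : LinOrd ℓ} (f : A ⩽ X) → (∀ a → P (proj₁ f a)) → A ⩽ Restrict
  ⩽Restrict⁺ (f , f-mono) Pf = (λ a → f a , fromWitness (Pf a)) , f-mono

  ⩽Restrict⁻ : {A : LinOrd ℓ} → A ⩽ Restrict → Σ (A ⩽ X) λ g → ∀ a → P (proj₁ g a)
  ⩽Restrict⁻ (f , f-mono) = ((λ a → proj₁ (f a)) , f-mono) , λ a → toWitness (proj₂ (f a))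

module _ (X : LinOrd ℓ) {P : Pred (Carrier X) p} (P? : Decidable P) (down : DownClosed X P) where

  private
    ¬P? : Decidable (λ x → ¬ P x)
    ¬P? x = ¬? (P? x)

  ≅-cut : X ≅ (Restrict X P? ⊕ Restrict X ¬P?)
  ≅-cut = to , from , from∘to , to∘from , to-mono , from-mono
    where
    place : ∀ x → True (P? x) ⊎ True (¬P? x) → Carrier (Restrict X P? ⊕ Restrict X ¬P?)
    place x (inj₁ t) = inj₁ (x , t)
    place x (inj₂ t) = inj₂ (x , t)

    to : Carrier X → Carrier (Restrict X P? ⊕ Restrict X ¬P?)
    to x = place x (decide (P? x))

    from : Carrier (Restrict X P? ⊕ Restrict X ¬P?) → Carrier X
    from (inj₁ (x , _)) = x
    from (inj₂ (x , _)) = x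

    from∘place : ∀ x s → from (place x s) ≡ x
    from∘place x (inj₁ _) = refl
    from∘place x (inj₂ _) = refl

    from∘to : ∀ x → from (to x) ≡ x
    from∘to x = from∘place x (decide (P? x))

    to∘from : ∀ a → to (from a) ≡ a
    to∘from (inj₁ (x , t)) = cong (place x) (decide-yes (P? x) t)
    to∘from (inj₂ (x , t)) = cong (place x) (decide-no (P? x) t)

    place-mono : ∀ {x y} → _<_ X x y → ∀ s s′ →
      SumLt (Restrict X P?) (Restrict X ¬P?) (place x s) (place y s′)
    place-mono x<y (inj₁ _) (inj₁ _) = ll x<y
    place-mono x<y (inj₁ _) (inj₂ _) = lr
    place-mono x<y (inj₂ t) (inj₁ u) = ⊥-elim (toWitness t (down x<y (toWitness u)))
    place-mono x<y (inj₂ _) (inj₂ _) = rr x<y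

    to-mono : ∀ x y → _<_ X x y → SumLt (Restrict X P?) (Restrict X ¬P?) (to x) (to y)
    to-mono x y x<y = place-mono x<y (decide (P? x)) (decide (P? y))

    from-mono : ∀ a b → SumLt (Restrict X P?) (Restrict X ¬P?) a b → _<_ X (from a) (from b)
    from-mono _ _ (ll x<y) = x<y
    from-mono _ _ (rr x<y) = x<y
    from-mono (inj₁ (x , t)) (inj₂ (y , u)) lr with trich X x y
    ... | inj₁ x<y = x<y
    ... | inj₂ (inj₁ refl) = ⊥-elim (toWitness u (toWitness t))
    ... | inj₂ (inj₂ y<x) = ⊥-elim (toWitness u (down y<x (toWitness t)))

  indecomposable-cut : Indecomposable X →
    (Σ (X ⩽ X) λ g → ∀ x → P (proj₁ g x)) ⊎ (Σ (X ⩽ X) λ g → ∀ x → ¬ P (proj₁ g x))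
  indecomposable-cut ind = Sum.map (⩽Restrict⁻ X P? {X}) (⩽Restrict⁻ X ¬P? {X}) (ind _ _ ≅-cut)

module _ {φ χ : LinOrd ℓ} (ind : Indecomposable φ) where

  private
    _∙_ : φ ⩽ φ → φ ⩽ φ → φ ⩽ φ
    _∙_ = _∘⩽_ {A = φ} {B = φ} {C = φ}

    _⊙_ : φ ⩽ χ → φ ⩽ φ → φ ⩽ χ
    _⊙_ = _∘⩽_ {A = φ} {B = φ} {C = χ}

  avoid-point-above : (h : φ ⩽ χ) (c : Carrier χ) → (∀ x → ¬ _<_ χ (proj₁ h x) c) →
    Irrelevant (Carrier φ) ⊎ Σ (φ ⩽ φ) (λ g → ∀ x → proj₁ h (proj₁ g x) ≢ c)
  avoid-point-above h c above
    with indecomposable-cut φ (λ x → ≡-dec χ (proj₁ h x) c) (≡-DownClosed χ {φ} h c above) ind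
  ... | inj₁ (g , at) = inj₁ (constant-⩽⇒irrelevant χ {φ} (h ⊙ g) c at)
  ... | inj₂ (g , not-at) = inj₂ (g , not-at)

  avoid-point : (f : φ ⩽ χ) (c : Carrier χ) →
    Irrelevant (Carrier φ) ⊎ Σ (φ ⩽ φ) (λ g → ∀ x → proj₁ f (proj₁ g x) ≢ c)
  avoid-point f c
    with indecomposable-cut φ (λ x → <-dec χ (proj₁ f x) c) (<-DownClosed χ {φ} f c) ind
  ... | inj₁ (g , below) = inj₂ (g , λ x → <⇒≢ χ (below x))
  ... | inj₂ (k , above) =
    Sum.map₂ (λ (g , avoids) → k ∙ g , avoids) (avoid-point-above (f ⊙ k) c above)

  avoid-list : (f : φ ⩽ χ) (cs : List (Carrier χ)) →
    Irrelevant (Carrier φ) ⊎ Σ (φ ⩽ φ) (λ g → ∀ x → proj₁ f (proj₁ g x) ∉ cs)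
  avoid-list f [] = inj₂ (⩽-refl {A = φ} , λ _ ())
  avoid-list f (c ∷ cs) with avoid-list f cs
  ... | inj₁ φ-irrelevant = inj₁ φ-irrelevant
  ... | inj₂ (g , avoids-cs) with avoid-point (f ⊙ g) c
  ...   | inj₁ φ-irrelevant = inj₁ φ-irrelevant
  ...   | inj₂ (g′ , avoids-c) = inj₂ (g ∙ g′ , λ x → λ
          { (here fx≡c) → avoids-c x fx≡c
          ; (there fx∈cs) → avoids-cs (proj₁ g′ x) fx∈cs
          })

module _ (X : LinOrd ℓ) where

  Between-sym : ∀ {a b w} → Between X a b w → Between X b a w
  Between-sym (inj₁ w∈[a,b]) = inj₂ w∈[a,b]
  Between-sym (inj₂ w∈[b,a]) = inj₁ w∈[b,a]

  Between-split : ∀ {a b} c {w} → Between X a b w → Between X a c w ⊎ Between X c b w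
  Between-split c {w} (inj₁ (a≤w , w≤b)) with trich X c w
  ... | inj₁ c<w = inj₂ (inj₁ (inj₁ c<w , w≤b))
  ... | inj₂ (inj₁ c≡w) = inj₂ (inj₁ (inj₂ c≡w , w≤b))
  ... | inj₂ (inj₂ w<c) = inj₁ (inj₁ (a≤w , inj₁ w<c))
  Between-split c {w} (inj₂ (b≤w , w≤a)) with trich X w c
  ... | inj₁ w<c = inj₂ (inj₂ (b≤w , inj₁ w<c))
  ... | inj₂ (inj₁ w≡c) = inj₂ (inj₂ (b≤w , inj₂ w≡c))
  ... | inj₂ (inj₂ c<w) = inj₁ (inj₂ (inj₁ c<w , w≤a))

  F-sym : ∀ {a b} → F X a b → F X b a
  F-sym (ws , covers) = ws , λ w w∈[b,a] → covers w (Between-sym w∈[b,a])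

  F-trans : ∀ {a b c} → F X a b → F X b c → F X a c
  F-trans {b = b} (ws , covers) (vs , covers′) = ws ++ vs , λ w w∈[a,c] →
    [ (λ w∈[a,b] → ∈-++⁺ˡ (covers w w∈[a,b]))
    , (λ w∈[b,c] → ∈-++⁺ʳ ws (covers′ w w∈[b,c])) ]
      (Between-split b w∈[a,c])

  FiniteClass-resp-F : ∀ {a b} → F X a b → FiniteClass X a → FiniteClass X b
  FiniteClass-resp-F Fab (ws , covers) = ws , λ w Fbw → covers w (F-trans Fab Fbw)

  finitelyManyFiniteClasses⇒finite : ExcludedMiddle ℓ →
    FinitelyManyFiniteClasses X → FiniteSet (FiniteClass X)
  finitelyManyFiniteClasses⇒finite em (rs , represent) = concatMap classList rs , covers
    where
    classList : Carrier X → List (Carrier X)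
    classList r with em {FiniteClass X r}
    ... | yes (ws , _) = ws
    ... | no _ = []

    ∈-classList : ∀ {r w} → FiniteClass X r → F X r w → w ∈ classList r
    ∈-classList {r} {w} r-finite Frw with em {FiniteClass X r}
    ... | yes (ws , covers) = covers w Frw
    ... | no r-infinite = ⊥-elim (r-infinite r-finite)

    covers : ∀ w → FiniteClass X w → w ∈ concatMap classList rs
    covers w w-finite with represent w w-finite
    ... | r , r∈rs , Fwr = ∈-concatMap⁺ classList
      (lose r∈rs (∈-classList (FiniteClass-resp-F Fwr w-finite) (F-sym Fwr)))

module _ (em : ExcludedMiddle ℓ) (X : LinOrd ℓ) where

  infinite? : Decidable (λ x → ¬ FiniteClass X x)
  infinite? x = em

  InfinitePart : LinOrd ℓ
  InfinitePart = Restrict X infinite?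

  InfinitePart-allClassesInfinite : AllClassesInfinite InfinitePart
  InfinitePart-allClassesInfinite (x , x-infinite) (ws , covers) =
    toWitness x-infinite (map proj₁ ws , λ z Fxz →
      ∈-map⁺ proj₁ (covers (z , z-infinite Fxz) (F-restrict X infinite? Fxz)))
    where
    z-infinite : ∀ {z} → F X x z → True (infinite? z)
    z-infinite Fxz = fromWitness λ z-finite →
      toWitness x-infinite (FiniteClass-resp-F X (F-sym X Fxz) z-finite)

lemma5p8 : ∀ {ℓ : Level} → ExcludedMiddle ℓ → (φ : LinOrd ℓ) →
    Indecomposable φ → ¬ (φ ≅ One) →
    Σ (LinOrd ℓ) (λ χ → Equimorphic φ χ × FinitelyManyFiniteClasses χ) →
    Σ (LinOrd ℓ) (λ χ → Equimorphic φ χ × AllClassesInfinite χ)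
lemma5p8 em φ ind φ≇1 (χ , (φ⩽χ , χ⩽φ) , finitelyMany)
  with finitePoints , covers ← finitelyManyFiniteClasses⇒finite χ em finitelyMany
  with avoid-list {φ = φ} {χ = χ} ind φ⩽χ finitePoints
... | inj₁ φ-irrelevant =
  φ , (⩽-refl {A = φ} , ⩽-refl {A = φ}) , λ x _ → φ≇1 (irrelevant⇒≅One φ φ-irrelevant x)
... | inj₂ (g , avoids) =
  InfinitePart em χ , (φ⩽χ′ , χ′⩽φ) , InfinitePart-allClassesInfinite em χ
  where
  φ⩽χ′ : φ ⩽ InfinitePart em χ
  φ⩽χ′ = ⩽Restrict⁺ χ (infinite? em χ) {φ} (_∘⩽_ {A = φ} {φ} {χ} φ⩽χ g)
    λ x finite → avoids x (covers _ finite)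

  χ′⩽φ : InfinitePart em χ ⩽ φ
  χ′⩽φ = _∘⩽_ {A = InfinitePart em χ} {χ} {φ} χ⩽φ (Restrict-⩽ χ (infinite? em χ))
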